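{- Let $t\ge 1$ be an integer and let $K_t$ be the complete graph on $t$ vertices. If $\Gamma$ is a finite simple graph with $A(\Gamma;x)=A(K_t;x)$, then $\Gamma$ is isomorphic to $K_t$.
   Context: All graphs are finite and simple with at least one vertex. For a graph $\Gamma=(V,E)$ of order $n$, a vertex $v$ and $X\subseteq V$, let $\delta_X(v)$ be the number of neighbours of $v$ in $X$, $\delta_1$ the maximum degree, and $\bar S=V\setminus S$. Let $\mathcal{K}=[-\delta_1,\delta_1]\cap\mathbb{Z}$. A nonempty $S\subseteq V$ is a defensive $k$-alliance if $\delta_S(v)\ge\delta_{\bar S}(v)+k$ for all $v\in S$. The exact index of alliance of a nonempty $S$ is $k_S=\max\{k\in\mathcal{K}: S \text{ is a defensive } k\text{ -alliance}\}$ (equivalently $k_S=\min_{v\in S}(\delta_S(v)-\delta_{\bar S}(v))$). The alliance polynomial is $A(\Gamma;x)=\sum_{S} x^{n+k_S}$, the sum over all nonempty $S\subseteq V$ whose induced subgraph $\langle S\rangle$ is connected. -}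

module Defs where

open import Data.Nat using (ℕ; zero; suc)
open import Data.Bool using (Bool; true; false; _∧_; _∨_; not; if_then_else_)
open import Data.Fin using (Fin)
open import Data.Fin.Properties using (_≟_)
open import Data.Vec using (Vec; []; _∷_; lookup)
open import Data.List using (List; []; _∷_; map; filter; foldr; length; allFin; _++_)
open import Data.Bool.ListAction using (any; all)
open import Data.Integer using (ℤ; +_; _-_; _⊓_; _+_)
open import Relation.Nullary.Decidable using (⌊_⌋)
open import Relation.Binary.PropositionalEquality using (_≡_)
open import Function.Bundles using (_↔_; Inverse)

record Graph : Set where
  field
    n      : ℕ
    adj    : Fin n → Fin n → Bool
    adj-sym   : ∀ u v → adj u v ≡ adj v u
    adj-irrefl : ∀ v → adj v v ≡ false
open Graph public

Subset : ℕ → Set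
Subset n = Vec Bool n

_∈ₛ_ : ∀ {n} → Fin n → Subset n → Bool
v ∈ₛ S = lookup S v

complementₛ : ∀ {n} → Subset n → Subset n
complementₛ = Data.Vec.map not

allSubsets : (n : ℕ) → List (Subset n)
allSubsets zero = [] ∷ []
allSubsets (suc n) = map (true ∷_) (allSubsets n) ++ map (false ∷_) (allSubsets n)

countB : ∀ {A : Set} → (A → Bool) → List A → ℕ
countB p xs = length (filter (λ x → Data.Bool._≟_ (p x) true) xs)

module _ (Γ : Graph) where
  private
    N = Graph.n Γ
    A = Graph.adj Γ

  degIn : Subset N → Fin N → ℕ
  degIn X v = countB (λ w → (w ∈ₛ X) ∧ A v w) (allFin N)

  nonemptyₛ : Subset N → Bool
  nonemptyₛ S = any (λ v → v ∈ₛ S) (allFin N)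

  reachIn : Subset N → ℕ → Fin N → Fin N → Bool
  reachIn S zero u v = ⌊ u ≟ v ⌋ ∧ (u ∈ₛ S)
  reachIn S (suc k) u v =
    reachIn S k u v ∨ any (λ w → reachIn S k u w ∧ A w v ∧ (v ∈ₛ S)) (allFin N)

  -- the induced subgraph ⟨S⟩ is connected (any two vertices of S are joined by
  -- a path inside S; a path has length < N)
  connectedₛ : Subset N → Bool
  connectedₛ S = all (λ u → all (λ v → not (u ∈ₛ S) ∨ not (v ∈ₛ S) ∨ reachIn S N u v) (allFin N)) (allFin N)

  minList : List ℤ → ℤ
  minList [] = + 0
  minList (x ∷ xs) = foldr _⊓_ x xs

  kIndex : Subset N → ℤ
  kIndex S = minList (map (λ v → + degIn S v - + degIn (complementₛ S) v)
                          (filter (λ v → Data.Bool._≟_ (v ∈ₛ S) true) (allFin N)))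

  -- coefficient of x^m in the alliance polynomial A(Γ;x) = Σ_S x^{n + k_S},
  -- S ranging over nonempty subsets with ⟨S⟩ connected
  allianceCoeff : ℤ → ℕ
  allianceCoeff m = countB
    (λ S → nonemptyₛ S ∧ connectedₛ S ∧ ⌊ Data.Integer._≟_ (+ N + kIndex S) m ⌋)
    (allSubsets N)

_≡A_ : Graph → Graph → Set
Γ ≡A Δ = ∀ (m : ℤ) → allianceCoeff Γ m ≡ allianceCoeff Δ m

K : ℕ → Graph
K t = record
  { n = t
  ; adj = λ u v → not ⌊ u ≟ v ⌋
  ; adj-sym = λ u v → sym' u v
  ; adj-irrefl = λ v → irr v
  }
  where
  open import Relation.Binary.PropositionalEquality using (refl; cong)
  open import Relation.Nullary using (yes; no)
  sym' : ∀ (u v : Fin t) → not ⌊ u ≟ v ⌋ ≡ not ⌊ v ≟ u ⌋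
  sym' u v with u ≟ v | v ≟ u
  ... | yes _ | yes _ = refl
  ... | no _ | no _ = refl
  ... | yes refl | no ¬p = Data.Empty.⊥-elim (¬p refl)
    where import Data.Empty
  ... | no ¬p | yes refl = Data.Empty.⊥-elim (¬p refl)
    where import Data.Empty
  irr : ∀ (v : Fin t) → not ⌊ v ≟ v ⌋ ≡ false
  irr v with v ≟ v
  ... | yes _ = refl
  ... | no ¬p = Data.Empty.⊥-elim (¬p refl)
    where import Data.Empty

_≅_ : Graph → Graph → Set
Γ ≅ Δ = Σ (Fin (Graph.n Γ) ↔ Fin (Graph.n Δ)) λ f →
  ∀ u v → Graph.adj Γ u v ≡ Graph.adj Δ (Inverse.to f u) (Inverse.to f v)
  where open import Data.Product using (Σ)

module Submission where

-- Two coefficients of the alliance polynomial pin Γ down.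
-- (1) The coefficient of x^1 counts the universal vertices: n + k_S = 1
--     forces a member v of S with no neighbour in S and n - 1 neighbours
--     outside, i.e. S = {v} with v universal; conversely such singletons
--     have exponent 1.  For K_t this coefficient is t, so Γ has exactly t
--     universal vertices, and in particular t ≤ n.
-- (2) Every exponent is at most n + (n - 1), so A(K_t;x) has degree at
--     most 2t - 1.  If n > t, every degree of Γ is at least t - 1 (each
--     vertex sees all universal vertices but itself) and the whole vertex
--     set, connected through a universal vertex, contributes a monomial of
--     degree n + k_V ≥ n + t - 1 > 2t - 1.  Hence n = t, every vertex is
--     universal and Γ is K_t.

open import Defs
open import Algebra.Properties.CommutativeSemigroup using (interchange)
open import Data.Bool using (Bool; true; false; _∧_; _∨_; not; T)
open import Data.Bool.ListAction using (any; all)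
open import Data.Bool.Properties using (T-≡; ∧-identityʳ; ∧-zeroʳ; ∨-zeroʳ)
open import Data.Empty using (⊥-elim)
open import Data.Fin using (Fin; zero; suc)
open import Data.Fin.Properties using (_≟_; suc-injective)
open import Data.Integer as ℤ using (ℤ; +_; +≤+; +<+)
import Data.Integer.Properties as ℤP
open import Data.Integer.Solver using (module +-*-Solver)
open import Data.List using (List; []; _∷_; map; filter; length; _++_; allFin; tabulate; foldr)
open import Data.List.Properties
  using (length-filter; filter-all; filter-none; filter-some; filter-≐; filter-++; length-++; length-tabulate; map-tabulate)
open import Data.List.Membership.Propositional using (_∈_; lose; find)
open import Data.List.Membership.Propositional.Properties
  using (∈-map⁺; ∈-map⁻; ∈-++⁺ˡ; ∈-++⁺ʳ; ∈-filter⁺; ∈-filter⁻; ∈-allFin)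
open import Data.List.Relation.Binary.Sublist.Propositional using (⊆-refl)
open import Data.List.Relation.Binary.Sublist.Propositional.Properties using (filter⁺; length-mono-≤)
open import Data.List.Relation.Unary.All using (universal)
import Data.List.Relation.Unary.All as All
open import Data.List.Relation.Unary.All.Properties using (all⁺; all⁻)
open import Data.List.Relation.Unary.Any using (here; there)
open import Data.List.Relation.Unary.Any.Properties using (any⁺; any⁻)
open import Data.Nat using (ℕ; zero; suc; _+_; _∸_; _≤_; _<_; _≤′_; ≤′-refl; ≤′-step; s≤s; z≤n)
open import Data.Nat.Properties
  using (≤-trans; ≤-reflexive; ≤-antisym; +-mono-≤; +-identityʳ; +-suc; <-irrefl; <⇒≱; ≮⇒≥; m≤m+n; m≤n+m;
         ≤⇒≤′; ∸-monoˡ-≤; +-commutativeSemigroup; module ≤-Reasoning)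
import Data.Nat.Properties as ℕP
open import Data.Product using (∃; _×_; _,_; proj₁; proj₂)
open import Data.Sum using (inj₁; inj₂)
open import Data.Vec using ([]; _∷_; lookup; replicate)
open import Data.Vec.Properties using (lookup-map; lookup-replicate)
open import Function using (_∘_; id; Equivalence)
open import Function.Construct.Identity using (↔-id)
open import Relation.Binary.PropositionalEquality
  using (_≡_; refl; sym; trans; cong; cong₂; subst; subst₂; module ≡-Reasoning)
open import Relation.Nullary using (¬_; Dec; yes; no)
open import Relation.Nullary.Decidable using (⌊_⌋; isYes≗does; dec-true; dec-false; toWitness)
import Data.Bool as Bool

false≢true : ¬ false ≡ true
false≢true ()

∧-elim : {a b : Bool} → (a ∧ b) ≡ true → a ≡ true × b ≡ true
∧-elim {true} {true} _ = refl , refl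

bool-ext : {a b : Bool} → (a ≡ true → b ≡ true) → (b ≡ true → a ≡ true) → a ≡ b
bool-ext {true} a⇒b _ = sym (a⇒b refl)
bool-ext {false} {true} _ b⇒a = b⇒a refl
bool-ext {false} {false} _ _ = refl

private variable A B : Set

bit : Bool → ℕ
bit true = 1
bit false = 0

countB-∷ : (p : A → Bool) (x : A) (xs : List A) → countB p (x ∷ xs) ≡ bit (p x) + countB p xs
countB-∷ p x xs with p x
... | true = refl
... | false = refl

bit-mono : {b c : Bool} → (b ≡ true → c ≡ true) → bit b ≤ bit c
bit-mono {false} _ = z≤n
bit-mono {true} b⇒c rewrite b⇒c refl = s≤s z≤n

bit-split : (b c : Bool) → bit (b ∧ c) + bit (not b ∧ c) ≡ bit c
bit-split true c = +-identityʳ (bit c)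
bit-split false c = refl

countB-cong : (p q : A → Bool) → (∀ x → p x ≡ q x) → (xs : List A) → countB p xs ≡ countB q xs
countB-cong p q p≗q xs =
  cong length (filter-≐ _ _ ((λ {x} px → trans (sym (p≗q x)) px) , (λ {x} qx → trans (p≗q x) qx)) xs)

countB-mono : (p q : A → Bool) → (∀ x → p x ≡ true → q x ≡ true) → (xs : List A) →
  countB p xs ≤ countB q xs
countB-mono p q p⇒q xs = length-mono-≤ (filter⁺ _ _ (λ { refl → p⇒q _ }) (⊆-refl {x = xs}))

countB-≤-length : (p : A → Bool) (xs : List A) → countB p xs ≤ length xs
countB-≤-length p xs = length-filter _ xs

countB-none : (p : A → Bool) → (∀ x → p x ≡ false) → (xs : List A) → countB p xs ≡ 0
countB-none p none xs = cong length (filter-none _ (universal (λ x px → false≢true (trans (sym (none x)) px)) xs))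

countB-every : (p : A → Bool) → (∀ x → p x ≡ true) → (xs : List A) → countB p xs ≡ length xs
countB-every p every xs = cong length (filter-all _ (universal every xs))

countB-++ : (p : A → Bool) (xs ys : List A) → countB p (xs ++ ys) ≡ countB p xs + countB p ys
countB-++ p xs ys = trans (cong length (filter-++ _ xs ys)) (length-++ (filter _ xs))

countB-map : (p : B → Bool) (f : A → B) (xs : List A) → countB p (map f xs) ≡ countB (p ∘ f) xs
countB-map p f [] = refl
countB-map p f (x ∷ xs) = begin
  countB p (map f (x ∷ xs))       ≡⟨ countB-∷ p (f x) (map f xs) ⟩
  bit (p (f x)) + countB p (map f xs) ≡⟨ cong (_+_ (bit (p (f x)))) (countB-map p f xs) ⟩
  bit (p (f x)) + countB (p ∘ f) xs ≡⟨ sym (countB-∷ (p ∘ f) x xs) ⟩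
  countB (p ∘ f) (x ∷ xs)         ∎
  where open ≡-Reasoning

countB-pos : (p : A → Bool) {x : A} {xs : List A} → x ∈ xs → p x ≡ true → 1 ≤ countB p xs
countB-pos p x∈xs px = filter-some _ (lose x∈xs px)

countB-witness : (p : A → Bool) (xs : List A) → 1 ≤ countB p xs → ∃ λ x → x ∈ xs × p x ≡ true
countB-witness p (x ∷ xs) pos = split (p x) refl (subst (1 ≤_) (countB-∷ p x xs) pos)
  where
  split : (b : Bool) → p x ≡ b → 1 ≤ bit b + countB p xs → ∃ λ y → y ∈ x ∷ xs × p y ≡ true
  split true px _ = x , here refl , px
  split false _ pos′ with y , y∈xs , py ← countB-witness p xs pos′ = y , there y∈xs , py

countB-split : (a p : A → Bool) (xs : List A) →
  countB (λ x → a x ∧ p x) xs + countB (λ x → not (a x) ∧ p x) xs ≡ countB p xs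
countB-split a p [] = refl
countB-split {A} a p (x ∷ xs) = begin
  countB P (x ∷ xs) + countB P̄ (x ∷ xs)
    ≡⟨ cong₂ _+_ (countB-∷ P x xs) (countB-∷ P̄ x xs) ⟩
  (bit (P x) + countB P xs) + (bit (P̄ x) + countB P̄ xs)
    ≡⟨ interchange +-commutativeSemigroup (bit (P x)) (countB P xs) (bit (P̄ x)) (countB P̄ xs) ⟩
  (bit (P x) + bit (P̄ x)) + (countB P xs + countB P̄ xs)
    ≡⟨ cong₂ _+_ (bit-split (a x) (p x)) (countB-split a p xs) ⟩
  bit (p x) + countB p xs
    ≡⟨ sym (countB-∷ p x xs) ⟩
  countB p (x ∷ xs) ∎
  where
  open ≡-Reasoning
  P P̄ : A → Bool
  P x = a x ∧ p x
  P̄ x = not (a x) ∧ p x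

countB-strict : (p q : A → Bool) → (∀ x → p x ≡ true → q x ≡ true) →
  {x : A} {xs : List A} → x ∈ xs → p x ≡ false → q x ≡ true → suc (countB p xs) ≤ countB q xs
countB-strict p q p⇒q {xs = x ∷ xs} (here refl) px qx = begin
  suc (countB p (x ∷ xs))     ≡⟨ cong suc (trans (countB-∷ p x xs) (cong (λ b → bit b + countB p xs) px)) ⟩
  suc (countB p xs)           ≤⟨ s≤s (countB-mono p q p⇒q xs) ⟩
  suc (countB q xs)           ≡⟨ sym (trans (countB-∷ q x xs) (cong (λ b → bit b + countB q xs) qx)) ⟩
  countB q (x ∷ xs)           ∎
  where open ≤-Reasoning
countB-strict p q p⇒q {xs = y ∷ xs} (there x∈xs) px qx = begin
  suc (countB p (y ∷ xs))        ≡⟨ cong suc (countB-∷ p y xs) ⟩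
  suc (bit (p y) + countB p xs)  ≡⟨ sym (+-suc (bit (p y)) (countB p xs)) ⟩
  bit (p y) + suc (countB p xs)  ≤⟨ +-mono-≤ (bit-mono (p⇒q y)) (countB-strict p q p⇒q x∈xs px qx) ⟩
  bit (q y) + countB q xs        ≡⟨ sym (countB-∷ q y xs) ⟩
  countB q (y ∷ xs)              ∎
  where open ≤-Reasoning

countB-full : (p : A → Bool) {x : A} {xs : List A} → countB p xs ≡ length xs → x ∈ xs → p x ≡ true
countB-full p {x} {xs} full x∈xs with p x in px
... | true = refl
... | false = ⊥-elim (<-irrefl (trans full (sym (countB-every (λ _ → true) (λ _ → refl) xs)))
                              (countB-strict p (λ _ → true) (λ _ _ → refl) x∈xs px refl))

any-intro : (p : A → Bool) {x : A} {xs : List A} → x ∈ xs → p x ≡ true → any p xs ≡ true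
any-intro p x∈xs px = Equivalence.to T-≡ (any⁺ p (lose {P = T ∘ p} x∈xs (Equivalence.from T-≡ px)))

any-elim : (p : A → Bool) (xs : List A) → any p xs ≡ true → ∃ λ x → x ∈ xs × p x ≡ true
any-elim p xs h with x , x∈xs , px ← find (any⁻ p xs (Equivalence.from T-≡ h)) =
  x , x∈xs , Equivalence.to T-≡ px

all-intro : (p : A → Bool) (xs : List A) → (∀ x → p x ≡ true) → all p xs ≡ true
all-intro p xs every = Equivalence.to T-≡ (all⁻ p (universal (λ x → Equivalence.from T-≡ (every x)) xs))

all-elim : (p : A → Bool) (xs : List A) → all p xs ≡ true → {x : A} → x ∈ xs → p x ≡ true
all-elim p xs h x∈xs = Equivalence.to T-≡ (All.lookup (all⁺ p xs (Equivalence.from T-≡ h)) x∈xs)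

module _ {P : Set} (P? : Dec P) where

  ⌊⌋-true : P → ⌊ P? ⌋ ≡ true
  ⌊⌋-true p = trans (isYes≗does P?) (dec-true P? p)

  ⌊⌋-false : ¬ P → ⌊ P? ⌋ ≡ false
  ⌊⌋-false ¬p = trans (isYes≗does P?) (dec-false P? ¬p)

  ⌊⌋-sound : ⌊ P? ⌋ ≡ true → P
  ⌊⌋-sound h = toWitness (Equivalence.from T-≡ h)

length-allFin : (N : ℕ) → length (allFin N) ≡ N
length-allFin N = length-tabulate id

countB-allFin-suc : (N : ℕ) (g : Fin (suc N) → Bool) →
  countB g (allFin (suc N)) ≡ bit (g zero) + countB (g ∘ suc) (allFin N)
countB-allFin-suc N g = begin
  countB g (zero ∷ tabulate suc)               ≡⟨ countB-∷ g zero (tabulate suc) ⟩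
  bit (g zero) + countB g (tabulate suc)       ≡⟨ cong (λ ws → bit (g zero) + countB g ws) (sym (map-tabulate id suc)) ⟩
  bit (g zero) + countB g (map suc (allFin N)) ≡⟨ cong (_+_ (bit (g zero))) (countB-map g suc (allFin N)) ⟩
  bit (g zero) + countB (g ∘ suc) (allFin N)   ∎
  where open ≡-Reasoning

countB-≟ : (N : ℕ) (v : Fin N) → countB (λ w → ⌊ w ≟ v ⌋) (allFin N) ≡ 1
countB-≟ (suc N) zero =
  trans (countB-allFin-suc N (λ w → ⌊ w ≟ zero ⌋)) (cong suc (countB-none _ (λ _ → refl) (allFin N)))
countB-≟ (suc N) (suc v) = begin
  countB (λ w → ⌊ w ≟ suc v ⌋) (allFin (suc N)) ≡⟨ countB-allFin-suc N (λ w → ⌊ w ≟ suc v ⌋) ⟩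
  countB (λ w → ⌊ suc w ≟ suc v ⌋) (allFin N)  ≡⟨ countB-cong _ _ suc-≟ (allFin N) ⟩
  countB (λ w → ⌊ w ≟ v ⌋) (allFin N)          ≡⟨ countB-≟ N v ⟩
  1                                             ∎
  where
  open ≡-Reasoning
  suc-≟ : (w : Fin N) → ⌊ Fin.suc w ≟ suc v ⌋ ≡ ⌊ w ≟ v ⌋
  suc-≟ w with w ≟ v
  ... | yes _ = refl
  ... | no _ = refl

countB-≢ : (N : ℕ) (v : Fin N) → suc (countB (λ w → not ⌊ w ≟ v ⌋) (allFin N)) ≡ N
countB-≢ N v = begin
  suc (countB (not ∘ is-v) (allFin N))
    ≡⟨ cong₂ _+_ (sym (trans (countB-cong _ _ (λ w → ∧-identityʳ (is-v w)) (allFin N)) (countB-≟ N v)))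
                 (sym (countB-cong _ _ (λ w → ∧-identityʳ (not (is-v w))) (allFin N))) ⟩
  countB (λ w → is-v w ∧ true) (allFin N) + countB (λ w → not (is-v w) ∧ true) (allFin N)
    ≡⟨ countB-split is-v (λ _ → true) (allFin N) ⟩
  countB (λ _ → true) (allFin N)
    ≡⟨ countB-every _ (λ _ → refl) (allFin N) ⟩
  length (allFin N)
    ≡⟨ length-allFin N ⟩
  N ∎
  where
  open ≡-Reasoning
  is-v : Fin N → Bool
  is-v w = ⌊ w ≟ v ⌋

∈-allSubsets : {N : ℕ} (S : Subset N) → S ∈ allSubsets N
∈-allSubsets [] = here refl
∈-allSubsets {suc N} (true ∷ S) = ∈-++⁺ˡ (∈-map⁺ (true ∷_) (∈-allSubsets S))
∈-allSubsets {suc N} (false ∷ S) = ∈-++⁺ʳ (map (true ∷_) (allSubsets N)) (∈-map⁺ (false ∷_) (∈-allSubsets S))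

countB-allSubsets-suc : (N : ℕ) (P : Subset (suc N) → Bool) →
  countB P (allSubsets (suc N)) ≡ countB (P ∘ (true ∷_)) (allSubsets N) + countB (P ∘ (false ∷_)) (allSubsets N)
countB-allSubsets-suc N P = trans (countB-++ P (map (true ∷_) (allSubsets N)) (map (false ∷_) (allSubsets N)))
  (cong₂ _+_ (countB-map P (true ∷_) (allSubsets N)) (countB-map P (false ∷_) (allSubsets N)))

isEmptyₛ : {N : ℕ} → Subset N → Bool
isEmptyₛ [] = true
isEmptyₛ (b ∷ S) = not b ∧ isEmptyₛ S

singletonWith : {N : ℕ} → (Fin N → Bool) → Subset N → Bool
singletonWith g [] = false
singletonWith g (true ∷ S) = g zero ∧ isEmptyₛ S
singletonWith g (false ∷ S) = singletonWith (g ∘ suc) S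

isEmptyₛ-intro : {N : ℕ} (S : Subset N) → (∀ w → lookup S w ≡ false) → isEmptyₛ S ≡ true
isEmptyₛ-intro [] _ = refl
isEmptyₛ-intro (b ∷ S) empty rewrite empty zero = isEmptyₛ-intro S (empty ∘ suc)

isEmptyₛ-elim : {N : ℕ} (S : Subset N) → isEmptyₛ S ≡ true → ∀ w → lookup S w ≡ false
isEmptyₛ-elim (false ∷ S) empty zero = refl
isEmptyₛ-elim (false ∷ S) empty (suc w) = isEmptyₛ-elim S empty w

singletonWith-intro : {N : ℕ} (g : Fin N → Bool) (S : Subset N) {v : Fin N} → g v ≡ true →
  lookup S v ≡ true → (∀ w → ¬ w ≡ v → lookup S w ≡ false) → singletonWith g S ≡ true
singletonWith-intro g (true ∷ S) {zero} gv _ others rewrite gv = isEmptyₛ-intro S (λ w → others (suc w) (λ ()))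
singletonWith-intro g (true ∷ S) {suc v} _ _ others with () ← others zero (λ ())
singletonWith-intro g (false ∷ S) {suc v} gv Sv others =
  singletonWith-intro (g ∘ suc) S gv Sv (λ w w≢v → others (suc w) (w≢v ∘ suc-injective))

singletonWith-elim : {N : ℕ} (g : Fin N → Bool) (S : Subset N) → singletonWith g S ≡ true →
  ∃ λ v → g v ≡ true × lookup S v ≡ true × (∀ w → ¬ w ≡ v → lookup S w ≡ false)
singletonWith-elim g (true ∷ S) h with g zero in g0
... | true = zero , g0 , refl , λ { zero 0≢0 → ⊥-elim (0≢0 refl) ; (suc w) _ → isEmptyₛ-elim S h w }
singletonWith-elim g (false ∷ S) h with v , gv , Sv , others ← singletonWith-elim (g ∘ suc) S h =
  suc v , gv , Sv , λ { zero _ → refl ; (suc w) w≢v → others w (w≢v ∘ cong suc) }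

countB-isEmptyₛ : (N : ℕ) → countB isEmptyₛ (allSubsets N) ≡ 1
countB-isEmptyₛ zero = refl
countB-isEmptyₛ (suc N) = trans (countB-allSubsets-suc N isEmptyₛ)
  (cong₂ _+_ (countB-none _ (λ _ → refl) (allSubsets N)) (countB-isEmptyₛ N))

countB-singletonWith : (N : ℕ) (g : Fin N → Bool) →
  countB (singletonWith g) (allSubsets N) ≡ countB g (allFin N)
countB-singletonWith zero g = refl
countB-singletonWith (suc N) g = begin
  countB (singletonWith g) (allSubsets (suc N))
    ≡⟨ countB-allSubsets-suc N (singletonWith g) ⟩
  countB (λ S → g zero ∧ isEmptyₛ S) (allSubsets N) + countB (singletonWith (g ∘ suc)) (allSubsets N)
    ≡⟨ cong₂ _+_ (countB-guarded (g zero)) (countB-singletonWith N (g ∘ suc)) ⟩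
  bit (g zero) + countB (g ∘ suc) (allFin N)
    ≡⟨ sym (countB-allFin-suc N g) ⟩
  countB g (allFin (suc N)) ∎
  where
  open ≡-Reasoning
  countB-guarded : (c : Bool) → countB (λ S → c ∧ isEmptyₛ S) (allSubsets N) ≡ bit c
  countB-guarded true = countB-isEmptyₛ N
  countB-guarded false = countB-none _ (λ _ → refl) (allSubsets N)

-- minList of a nonempty list of integers is a lower bound of it, its
-- greatest lower bound, and one of its members
-- (minList is declared in Defs inside a module over a graph it does not use)
module _ (Γ : Graph) where

  minList-≤ : {y : ℤ} (ys : List ℤ) → y ∈ ys → minList Γ ys ℤ.≤ y
  minList-≤ [] ()
  minList-≤ (x ∷ xs) = foldr-≤ x xs
    where
    foldr-≤ : ∀ x xs {y} → y ∈ x ∷ xs → foldr ℤ._⊓_ x xs ℤ.≤ y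
    foldr-≤ x [] (here refl) = ℤP.≤-refl
    foldr-≤ x (z ∷ zs) (here refl) = ℤP.≤-trans (ℤP.i⊓j≤j z _) (foldr-≤ x zs (here refl))
    foldr-≤ x (z ∷ zs) (there (here refl)) = ℤP.i⊓j≤i z _
    foldr-≤ x (z ∷ zs) (there (there y∈zs)) = ℤP.≤-trans (ℤP.i⊓j≤j z _) (foldr-≤ x zs (there y∈zs))

  minList-glb : {b y₀ : ℤ} (ys : List ℤ) → y₀ ∈ ys → (∀ y → y ∈ ys → b ℤ.≤ y) → b ℤ.≤ minList Γ ys
  minList-glb [] ()
  minList-glb (x ∷ xs) _ = foldr-glb x xs
    where
    foldr-glb : ∀ x xs {b} → (∀ y → y ∈ x ∷ xs → b ℤ.≤ y) → b ℤ.≤ foldr ℤ._⊓_ x xs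
    foldr-glb x [] below = below x (here refl)
    foldr-glb x (z ∷ zs) below = ℤP.⊓-glb (below z (there (here refl)))
      (foldr-glb x zs λ { y (here y≡x) → below y (here y≡x) ; y (there y∈zs) → below y (there (there y∈zs)) })

  minList-∈ : {y₀ : ℤ} (ys : List ℤ) → y₀ ∈ ys → minList Γ ys ∈ ys
  minList-∈ [] ()
  minList-∈ (x ∷ xs) _ = foldr-∈ x xs
    where
    foldr-∈ : ∀ x xs → foldr ℤ._⊓_ x xs ∈ x ∷ xs
    foldr-∈ x [] = here refl
    foldr-∈ x (z ∷ zs) with ℤP.⊓-sel z (foldr ℤ._⊓_ x zs)
    ... | inj₁ z⊓m≡z rewrite z⊓m≡z = there (here refl)
    ... | inj₂ z⊓m≡m rewrite z⊓m≡m with foldr-∈ x zs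
    ...   | here m≡x = here m≡x
    ...   | there m∈zs = there (there m∈zs)

exponent-one-arith : (N a b : ℕ) → + N ℤ.+ (+ a ℤ.- + b) ≡ + 1 → N + a ≡ suc b
exponent-one-arith N a b e = ℤP.+-injective (begin
  + (N + a)                       ≡⟨ ℤP.pos-+ N a ⟩
  + N ℤ.+ + a                     ≡⟨ solve 3 (λ n x y → n :+ x := (n :+ (x :- y)) :+ y) refl (+ N) (+ a) (+ b) ⟩
  (+ N ℤ.+ (+ a ℤ.- + b)) ℤ.+ + b ≡⟨ cong (ℤ._+ + b) e ⟩
  + 1 ℤ.+ + b                     ≡⟨ sym (ℤP.pos-+ 1 b) ⟩
  + suc b                         ∎)
  where
  open ≡-Reasoning
  open +-*-Solver

exponent-isolated : (d : ℕ) → + suc d ℤ.+ (+ 0 ℤ.- + d) ≡ + 1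
exponent-isolated d = begin
  + suc d ℤ.+ (+ 0 ℤ.- + d)       ≡⟨ cong (ℤ._+ (+ 0 ℤ.- + d)) (ℤP.pos-+ 1 d) ⟩
  (+ 1 ℤ.+ + d) ℤ.+ (+ 0 ℤ.- + d) ≡⟨ solve 1 (λ x → (con (+ 1) :+ x) :+ (con (+ 0) :- x) := con (+ 1)) refl (+ d) ⟩
  + 1                             ∎
  where
  open ≡-Reasoning
  open +-*-Solver

no-room : (N a b : ℕ) → N + a ≡ suc b → suc (a + b) ≤ N → a ≡ 0
no-room N zero b _ _ = refl
no-room N (suc a) b eq bound = ⊥-elim (<⇒≱ b<N N≤b)
  where
  b<N : b < N
  b<N = ≤-trans (s≤s (m≤n+m b (suc a))) bound
  N≤b : N ≤ b
  N≤b = subst (N ≤_) (ℕP.suc-injective (trans (sym (+-suc N a)) eq)) (m≤m+n N a)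

module GraphFacts (Γ : Graph) where

  N : ℕ
  N = Graph.n Γ

  edge : Fin N → Fin N → Bool
  edge = Graph.adj Γ

  deg : Fin N → ℕ
  deg v = countB (edge v) (allFin N)

  isUniversal : Fin N → Bool
  isUniversal v = all (λ w → ⌊ w ≟ v ⌋ ∨ edge v w) (allFin N)

  universal-edge : {v w : Fin N} → isUniversal v ≡ true → ¬ w ≡ v → edge v w ≡ true
  universal-edge {v} {w} univ w≢v =
    subst (λ b → (b ∨ edge v w) ≡ true) (⌊⌋-false (w ≟ v) w≢v) (all-elim _ (allFin N) univ (∈-allFin w))

  universal-intro : {v : Fin N} → (∀ w → ¬ w ≡ v → edge v w ≡ true) → isUniversal v ≡ true
  universal-intro {v} adjacent = all-intro _ (allFin N) covered
    where
    covered : ∀ w → (⌊ w ≟ v ⌋ ∨ edge v w) ≡ true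
    covered w with w ≟ v
    ... | yes _ = refl
    ... | no w≢v = adjacent w w≢v

  edge⇒≢ : {v : Fin N} (w : Fin N) → edge v w ≡ true → not ⌊ w ≟ v ⌋ ≡ true
  edge⇒≢ {v} w vw with w ≟ v
  ... | yes refl = ⊥-elim (false≢true (trans (sym (Graph.adj-irrefl Γ v)) vw))
  ... | no _ = refl

  deg-bound : (v : Fin N) → suc (deg v) ≤ N
  deg-bound v = subst (suc (deg v) ≤_) (countB-≢ N v) (s≤s (countB-mono (edge v) _ edge⇒≢ (allFin N)))

  universal⇒full-degree : {v : Fin N} → isUniversal v ≡ true → suc (deg v) ≡ N
  universal⇒full-degree {v} univ = trans (cong suc (countB-cong (edge v) _ edge-or-self (allFin N))) (countB-≢ N v)
    where
    edge-or-self : ∀ w → edge v w ≡ not ⌊ w ≟ v ⌋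
    edge-or-self w with w ≟ v
    ... | yes refl = Graph.adj-irrefl Γ v
    ... | no w≢v = universal-edge univ w≢v

  -- a vertex of degree N - 1 is universal: a missing edge would lower its degree
  full-degree⇒universal : {v : Fin N} → suc (deg v) ≡ N → isUniversal v ≡ true
  full-degree⇒universal {v} full = universal-intro adjacent
    where
    adjacent : ∀ w → ¬ w ≡ v → edge v w ≡ true
    adjacent w w≢v with edge v w in vw
    ... | true = refl
    ... | false = ⊥-elim (<-irrefl (trans full (sym (countB-≢ N v)))
      (s≤s (countB-strict (edge v) _ edge⇒≢ (∈-allFin w) vw (cong not (⌊⌋-false (w ≟ v) w≢v)))))

  -- every universal vertex other than w is a neighbour of w
  universals≤ : (w : Fin N) → countB isUniversal (allFin N) ≤ suc (deg w)
  universals≤ w = begin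
    countB isUniversal (allFin N)
      ≡⟨ sym (countB-split is-w isUniversal (allFin N)) ⟩
    countB (λ x → is-w x ∧ isUniversal x) (allFin N) + countB (λ x → not (is-w x) ∧ isUniversal x) (allFin N)
      ≤⟨ +-mono-≤ (countB-mono _ is-w (λ x h → proj₁ (∧-elim h)) (allFin N))
                   (countB-mono _ (edge w) neighbour (allFin N)) ⟩
    countB is-w (allFin N) + deg w
      ≡⟨ cong (_+ deg w) (countB-≟ N w) ⟩
    suc (deg w) ∎
    where
    open ≤-Reasoning
    is-w : Fin N → Bool
    is-w x = ⌊ x ≟ w ⌋
    neighbour : ∀ x → (not (is-w x) ∧ isUniversal x) ≡ true → edge w x ≡ true
    neighbour x h with x ≟ w | h
    ... | no x≢w | univ = trans (Graph.adj-sym Γ w x) (universal-edge univ (x≢w ∘ sym))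

  degIn-split : (S : Subset N) (v : Fin N) → degIn Γ S v + degIn Γ (complementₛ S) v ≡ deg v
  degIn-split S v = trans (cong (_+_ (degIn Γ S v)) complement) (countB-split (lookup S) (edge v) (allFin N))
    where
    complement : degIn Γ (complementₛ S) v ≡ countB (λ w → not (lookup S w) ∧ edge v w) (allFin N)
    complement = countB-cong _ _ (λ w → cong (_∧ edge v w) (lookup-map w not S)) (allFin N)

  degIn-bound : (X : Subset N) (v : Fin N) → degIn Γ X v ≤ N ∸ 1
  degIn-bound X v = ≤-trans (countB-mono _ (edge v) (λ w h → proj₂ (∧-elim h)) (allFin N)) (∸-monoˡ-≤ 1 (deg-bound v))

  excess : Subset N → Fin N → ℤ
  excess S v = + degIn Γ S v ℤ.- + degIn Γ (complementₛ S) v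

  members : Subset N → List (Fin N)
  members S = filter (λ v → lookup S v Bool.≟ true) (allFin N)

  excess∈ : (S : Subset N) {v : Fin N} → lookup S v ≡ true → excess S v ∈ map (excess S) (members S)
  excess∈ S {v} Sv = ∈-map⁺ (excess S) (∈-filter⁺ (λ w → lookup S w Bool.≟ true) (∈-allFin v) Sv)

  kIndex-≤ : (S : Subset N) {v : Fin N} → lookup S v ≡ true → kIndex Γ S ℤ.≤ excess S v
  kIndex-≤ S Sv = minList-≤ Γ (map (excess S) (members S)) (excess∈ S Sv)

  kIndex-glb : (S : Subset N) {v₀ : Fin N} {b : ℤ} → lookup S v₀ ≡ true →
    (∀ v → lookup S v ≡ true → b ℤ.≤ excess S v) → b ℤ.≤ kIndex Γ S
  kIndex-glb S Sv₀ below = minList-glb Γ (map (excess S) (members S)) (excess∈ S Sv₀) bound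
    where
    bound : ∀ y → y ∈ map (excess S) (members S) → _ ℤ.≤ y
    bound y y∈ with v , v∈ , refl ← ∈-map⁻ (excess S) y∈ =
      below v (proj₂ (∈-filter⁻ (λ w → lookup S w Bool.≟ true) {xs = allFin N} v∈))

  kIndex-attained : (S : Subset N) {v₀ : Fin N} → lookup S v₀ ≡ true →
    ∃ λ v → lookup S v ≡ true × kIndex Γ S ≡ excess S v
  kIndex-attained S Sv₀
    with v , v∈ , k≡ ← ∈-map⁻ (excess S) (minList-∈ Γ (map (excess S) (members S)) (excess∈ S Sv₀)) =
    v , proj₂ (∈-filter⁻ (λ w → lookup S w Bool.≟ true) {xs = allFin N} v∈) , k≡

  kIndex-bound : (S : Subset N) → nonemptyₛ Γ S ≡ true → kIndex Γ S ℤ.≤ + (N ∸ 1)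
  kIndex-bound S nonempty with v , _ , Sv ← any-elim (lookup S) (allFin N) nonempty = begin
    kIndex Γ S        ≤⟨ kIndex-≤ S Sv ⟩
    excess S v        ≤⟨ ℤP.i-j≤i (+ degIn Γ S v) (+ degIn Γ (complementₛ S) v) ⟩
    + degIn Γ S v     ≤⟨ +≤+ (degIn-bound S v) ⟩
    + (N ∸ 1)         ∎
    where open ℤP.≤-Reasoning

  reach-refl : (S : Subset N) {u : Fin N} → lookup S u ≡ true → reachIn Γ S 0 u u ≡ true
  reach-refl S {u} Su = cong₂ _∧_ (⌊⌋-true (u ≟ u) refl) Su

  reach-suc : (S : Subset N) (k : ℕ) {u w : Fin N} → reachIn Γ S k u w ≡ true → reachIn Γ S (suc k) u w ≡ true
  reach-suc S k reach rewrite reach = refl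

  reach-step : (S : Subset N) (k : ℕ) {u x w : Fin N} → reachIn Γ S k u x ≡ true → edge x w ≡ true →
    lookup S w ≡ true → reachIn Γ S (suc k) u w ≡ true
  reach-step S k {u} {x} {w} reach xw Sw
    rewrite any-intro (λ y → reachIn Γ S k u y ∧ edge y w ∧ lookup S w) (∈-allFin x)
              (cong₂ _∧_ reach (cong₂ _∧_ xw Sw)) = ∨-zeroʳ _

  reach-weaken : (S : Subset N) {k m : ℕ} {u w : Fin N} → k ≤ m → reachIn Γ S k u w ≡ true → reachIn Γ S m u w ≡ true
  reach-weaken S k≤m = go (≤⇒≤′ k≤m)
    where
    go : ∀ {k m u w} → k ≤′ m → reachIn Γ S k u w ≡ true → reachIn Γ S m u w ≡ true
    go ≤′-refl reach = reach
    go {m = suc m} (≤′-step k≤′m) reach = reach-suc S m (go k≤′m reach)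

  connected-intro : (S : Subset N) →
    (∀ u w → lookup S u ≡ true → lookup S w ≡ true → reachIn Γ S N u w ≡ true) → connectedₛ Γ S ≡ true
  connected-intro S joined = all-intro _ (allFin N) λ u → all-intro _ (allFin N) λ w → joins u w
    where
    joins : ∀ u w → (not (lookup S u) ∨ not (lookup S w) ∨ reachIn Γ S N u w) ≡ true
    joins u w with lookup S u in Su | lookup S w in Sw
    ... | true | true = joined u w Su Sw
    ... | true | false = refl
    ... | false | _ = refl

  nonempty-intro : (S : Subset N) {v : Fin N} → lookup S v ≡ true → nonemptyₛ Γ S ≡ true
  nonempty-intro S {v} Sv = any-intro (lookup S) (∈-allFin v) Sv

  contributes : ℤ → Subset N → Bool
  contributes m S = nonemptyₛ Γ S ∧ connectedₛ Γ S ∧ ⌊ + N ℤ.+ kIndex Γ S ℤ.≟ m ⌋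

  exponent-one : (S : Subset N) (v : Fin N) → + N ℤ.+ excess S v ≡ + 1 →
    degIn Γ S v ≡ 0 × suc (deg v) ≡ N
  exponent-one S v e = a≡0 , full
    where
    a b : ℕ
    a = degIn Γ S v
    b = degIn Γ (complementₛ S) v
    N+a≡1+b : N + a ≡ suc b
    N+a≡1+b = exponent-one-arith N a b e
    a≡0 : a ≡ 0
    a≡0 = no-room N a b N+a≡1+b (subst (λ d → suc d ≤ N) (sym (degIn-split S v)) (deg-bound v))
    full : suc (deg v) ≡ N
    full = begin
      suc (deg v)   ≡⟨ cong suc (sym (degIn-split S v)) ⟩
      suc (a + b)   ≡⟨ cong (λ x → suc (x + b)) a≡0 ⟩
      suc b         ≡⟨ sym N+a≡1+b ⟩
      N + a         ≡⟨ cong (_+_ N) a≡0 ⟩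
      N + 0         ≡⟨ +-identityʳ N ⟩
      N             ∎
      where open ≡-Reasoning

  unit⇒universal-singleton : (S : Subset N) → contributes (+ 1) S ≡ true → singletonWith isUniversal S ≡ true
  unit⇒universal-singleton S h
    with nonempty , rest ← ∧-elim h
    with _ , exponent ← ∧-elim {connectedₛ Γ S} rest
    with _ , _ , Sv₀ ← any-elim (lookup S) (allFin N) nonempty
    with v , Sv , k≡ ← kIndex-attained S Sv₀
    with isolated , full ← exponent-one S v (trans (cong (λ k → + N ℤ.+ k) (sym k≡)) (⌊⌋-sound (_ ℤ.≟ _) exponent)) =
    singletonWith-intro isUniversal S (full-degree⇒universal full) Sv outside
    where
    outside : ∀ w → ¬ w ≡ v → lookup S w ≡ false
    outside w w≢v with lookup S w in Sw
    ... | false = refl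
    ... | true = ⊥-elim (<⇒≱ (countB-pos _ (∈-allFin w) (cong₂ _∧_ Sw (universal-edge (full-degree⇒universal full) w≢v)))
                                (≤-reflexive isolated))

  universal-singleton⇒unit : (S : Subset N) → singletonWith isUniversal S ≡ true → contributes (+ 1) S ≡ true
  universal-singleton⇒unit S h with v , univ , Sv , outside ← singletonWith-elim isUniversal S h = unit
    where
    only-v : ∀ {w} → lookup S w ≡ true → w ≡ v
    only-v {w} Sw with w ≟ v
    ... | yes w≡v = w≡v
    ... | no w≢v = ⊥-elim (false≢true (trans (sym (outside w w≢v)) Sw))
    joined : ∀ u w → lookup S u ≡ true → lookup S w ≡ true → reachIn Γ S N u w ≡ true
    joined u w Su Sw with refl ← only-v Su | refl ← only-v Sw = reach-weaken S {m = N} z≤n (reach-refl S Sv)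
    isolated : degIn Γ S v ≡ 0
    isolated = countB-none _ no-neighbour (allFin N)
      where
      no-neighbour : ∀ w → (lookup S w ∧ edge v w) ≡ false
      no-neighbour w with w ≟ v
      ... | yes refl = trans (cong (lookup S w ∧_) (Graph.adj-irrefl Γ w)) (∧-zeroʳ _)
      ... | no w≢v rewrite outside w w≢v = refl
    index : kIndex Γ S ≡ excess S v
    index = ℤP.≤-antisym (kIndex-≤ S Sv) (kIndex-glb S Sv λ w Sw → ℤP.≤-reflexive (cong (excess S) (sym (only-v Sw))))
    outside-degree : degIn Γ (complementₛ S) v ≡ deg v
    outside-degree = subst (λ a → a + degIn Γ (complementₛ S) v ≡ deg v) isolated (degIn-split S v)
    exponent : + N ℤ.+ kIndex Γ S ≡ + 1
    exponent = begin
      + N ℤ.+ kIndex Γ S              ≡⟨ cong (λ k → + N ℤ.+ k) index ⟩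
      + N ℤ.+ excess S v              ≡⟨ cong₂ (λ n a → + n ℤ.+ (+ a ℤ.- + b)) N≡1+b isolated ⟩
      + suc b ℤ.+ (+ 0 ℤ.- + b)       ≡⟨ exponent-isolated b ⟩
      + 1                             ∎
      where
      open ≡-Reasoning
      b : ℕ
      b = degIn Γ (complementₛ S) v
      N≡1+b : N ≡ suc b
      N≡1+b = trans (sym (universal⇒full-degree univ)) (cong suc (sym outside-degree))
    unit : contributes (+ 1) S ≡ true
    unit rewrite nonempty-intro S Sv | connected-intro S joined = ⌊⌋-true (_ ℤ.≟ _) exponent

  coefficient-one : allianceCoeff Γ (+ 1) ≡ countB isUniversal (allFin N)
  coefficient-one = begin
    countB (contributes (+ 1)) (allSubsets N)
      ≡⟨ countB-cong _ _ (λ S → bool-ext (unit⇒universal-singleton S) (universal-singleton⇒unit S)) (allSubsets N) ⟩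
    countB (singletonWith isUniversal) (allSubsets N)
      ≡⟨ countB-singletonWith N isUniversal ⟩
    countB isUniversal (allFin N) ∎
    where open ≡-Reasoning

  coefficient-vanishes : (m : ℤ) → + N ℤ.+ + (N ∸ 1) ℤ.< m → allianceCoeff Γ m ≡ 0
  coefficient-vanishes m above = countB-none (contributes m) absent (allSubsets N)
    where
    absent : ∀ S → contributes m S ≡ false
    absent S with nonemptyₛ Γ S in nonempty
    ... | false = refl
    ... | true = trans (cong (connectedₛ Γ S ∧_) (⌊⌋-false (_ ℤ.≟ m) exponent≢m)) (∧-zeroʳ (connectedₛ Γ S))
      where
      exponent≢m : ¬ + N ℤ.+ kIndex Γ S ≡ m
      exponent≢m refl = ℤP.<⇒≱ above (ℤP.+-monoʳ-≤ (+ N) (kIndex-bound S nonempty))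

  -- the whole vertex set V: its index is the minimum degree
  V : Subset N
  V = replicate N true

  kIndex-V : (u : Fin N) {c : ℕ} → (∀ w → c ≤ deg w) → + c ℤ.≤ kIndex Γ V
  kIndex-V u {c} c≤deg = kIndex-glb V (lookup-replicate u true) λ w _ →
    ℤP.≤-trans (+≤+ (c≤deg w)) (ℤP.≤-reflexive (sym (excess-V w)))
    where
    excess-V : ∀ w → excess V w ≡ + deg w
    excess-V w = begin
      + degIn Γ V w ℤ.- + degIn Γ (complementₛ V) w ≡⟨ cong₂ (λ a b → + a ℤ.- + b) inside outside ⟩
      + deg w ℤ.- + 0                              ≡⟨ ℤP.+-identityʳ (+ deg w) ⟩
      + deg w                                      ∎
      where
      open ≡-Reasoning
      inside : degIn Γ V w ≡ deg w
      inside = countB-cong _ _ (λ x → cong (_∧ edge w x) (lookup-replicate x true)) (allFin N)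
      outside : degIn Γ (complementₛ V) w ≡ 0
      outside = countB-none _ (λ x → cong (_∧ edge w x) (trans (lookup-map x not V) (cong not (lookup-replicate x true))))
                  (allFin N)

  -- with a universal vertex u, any two vertices are joined through u
  V-connected : {u : Fin N} → isUniversal u ≡ true → 2 ≤ N → connectedₛ Γ V ≡ true
  V-connected {u} univ 2≤N = connected-intro V λ x y _ _ → reach-weaken V 2≤N (via-u x y (y ≟ u))
    where
    in-V : ∀ x → lookup V x ≡ true
    in-V x = lookup-replicate x true
    -- (split on a separate Dec value: `with x ≟ u` would also rewrite the goal,
    -- whose unfolding mentions x ≟ u)
    to-u : ∀ x → Dec (x ≡ u) → reachIn Γ V 1 x u ≡ true
    to-u x (yes refl) = reach-suc V 0 (reach-refl V (in-V x))
    to-u x (no x≢u) = reach-step V 0 (reach-refl V (in-V x)) (trans (Graph.adj-sym Γ x u) (universal-edge univ x≢u)) (in-V u)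
    via-u : ∀ x y → Dec (y ≡ u) → reachIn Γ V 2 x y ≡ true
    via-u x y (yes refl) = reach-suc V 1 (to-u x (x ≟ u))
    via-u x y (no y≢u) = reach-step V 1 (to-u x (x ≟ u)) (universal-edge univ y≢u) (in-V y)

  coefficient-V : {u : Fin N} → isUniversal u ≡ true → 2 ≤ N → 1 ≤ allianceCoeff Γ (+ N ℤ.+ kIndex Γ V)
  coefficient-V {u} univ 2≤N = countB-pos (contributes _) (∈-allSubsets V) counted
    where
    counted : contributes (+ N ℤ.+ kIndex Γ V) V ≡ true
    counted rewrite nonempty-intro V (lookup-replicate u true) | V-connected univ 2≤N = ⌊⌋-true (_ ℤ.≟ _) refl

  -- t ≥ 1 universal vertices but more than t vertices: then every degree is
  -- at least t - 1, so V contributes a monomial of degree N + k_V > 2t - 1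
  high-monomial : (t : ℕ) → 1 ≤ t → t < N → countB isUniversal (allFin N) ≡ t →
    ∃ λ m → (+ t ℤ.+ + (t ∸ 1) ℤ.< m) × 1 ≤ allianceCoeff Γ m
  high-monomial t 1≤t t<N universals
    with u , _ , univ ← countB-witness isUniversal (allFin N) (subst (1 ≤_) (sym universals) 1≤t) =
    + N ℤ.+ kIndex Γ V , above , coefficient-V univ (≤-trans (s≤s 1≤t) t<N)
    where
    min-degree : ∀ w → t ∸ 1 ≤ deg w
    min-degree w = ∸-monoˡ-≤ 1 (subst (_≤ suc (deg w)) universals (universals≤ w))
    above : + t ℤ.+ + (t ∸ 1) ℤ.< + N ℤ.+ kIndex Γ V
    above = ℤP.<-≤-trans (ℤP.+-monoˡ-< (+ (t ∸ 1)) (+<+ t<N)) (ℤP.+-monoʳ-≤ (+ N) (kIndex-V u min-degree))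

K-universal : (t : ℕ) (v : Fin t) → GraphFacts.isUniversal (K t) v ≡ true
K-universal t v = GraphFacts.universal-intro (K t) λ w w≢v → cong not (⌊⌋-false (v ≟ w) (w≢v ∘ sym))

complete⇒≅K : (Γ : Graph) → (∀ v → GraphFacts.isUniversal Γ v ≡ true) → Γ ≅ K (Graph.n Γ)
complete⇒≅K Γ all-universal = ↔-id (Fin N) , adjacency
  where
  open GraphFacts Γ using (N; universal-edge)
  adjacency : ∀ u v → Graph.adj Γ u v ≡ not ⌊ u ≟ v ⌋
  adjacency u v with u ≟ v
  ... | yes refl = Graph.adj-irrefl Γ u
  ... | no u≢v = universal-edge (all-universal u) (u≢v ∘ sym)

universal-count : (t : ℕ) (Γ : Graph) → Γ ≡A K t → countB (GraphFacts.isUniversal Γ) (allFin (Graph.n Γ)) ≡ t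
universal-count t Γ same = begin
  countB isUniversal (allFin N)                    ≡⟨ sym coefficient-one ⟩
  allianceCoeff Γ (+ 1)                            ≡⟨ same (+ 1) ⟩
  allianceCoeff (K t) (+ 1)                        ≡⟨ GraphFacts.coefficient-one (K t) ⟩
  countB (GraphFacts.isUniversal (K t)) (allFin t) ≡⟨ countB-every _ (K-universal t) (allFin t) ⟩
  length (allFin t)                                ≡⟨ length-allFin t ⟩
  t                                                ∎
  where
  open ≡-Reasoning
  open GraphFacts Γ using (N; isUniversal; coefficient-one)

order-bound : (t : ℕ) → 1 ≤ t → (Γ : Graph) → Γ ≡A K t → Graph.n Γ ≤ t
order-bound t 1≤t Γ same = ≮⇒≥ λ t<N →
  let m , above , positive = GraphFacts.high-monomial Γ t 1≤t t<N (universal-count t Γ same) in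
  <⇒≱ positive (≤-reflexive (trans (same m) (GraphFacts.coefficient-vanishes (K t) m above)))

theorem3p9 : (t : ℕ) → 1 ≤ t → (Γ : Graph) → 1 ≤ Graph.n Γ →
    Γ ≡A K t → Γ ≅ K t
theorem3p9 t 1≤t Γ _ same = subst (λ s → Γ ≅ K s) N≡t (complete⇒≅K Γ all-universal)
  where
  open GraphFacts Γ using (N; isUniversal)
  universals : countB isUniversal (allFin N) ≡ t
  universals = universal-count t Γ same
  N≡t : Graph.n Γ ≡ t
  N≡t = ≤-antisym (order-bound t 1≤t Γ same)
          (subst₂ _≤_ universals (length-allFin N) (countB-≤-length isUniversal (allFin N)))
  all-universal : ∀ v → isUniversal v ≡ true
  all-universal v = countB-full isUniversal (trans universals (trans (sym N≡t) (sym (length-allFin N)))) (∈-allFin v)
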